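{- Let $p$ be an odd prime and let $P\in\mathbb{F}_p[x]$ be a polynomial of degree $\frac{p-1}{2}$ with $\sum_{x\in\mathbb{F}_p}P(x)=p$ (values regarded as integers in $\{0,\dots,p-1\}$, sum in $\mathbb{Z}$). Let $c\in\{1,\dots,p-1\}$ be the leading coefficient of $P$, regarded as an integer. For $\gamma\in\mathbb{F}_p$ define the integer $$r_\gamma:=\sum_{a\in\mathbb{F}_p:\,P(a)=0}\left(\frac{a-\gamma}{p}\right)\;-\;\sum_{x\in\mathbb{F}_p:\,P(x)\ge 1}\big(P(x)-1\big)\left(\frac{x-\gamma}{p}\right).$$ Then $|\{\gamma\in\mathbb{F}_p: r_\gamma=c-p\}|=c$ and $|\{\gamma\in\mathbb{F}_p: r_\gamma=c\}|=p-c$.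
   Context: Elements of $\mathbb{F}_p$ are identified with the integers $\{0,1,\dots,p-1\}$. $\left(\frac{\cdot}{p}\right)$ denotes the Legendre symbol (with value $0$ at $0$). In the second sum, $P(x)$ is the integer in $\{0,\dots,p-1\}$ representing the value. -}

module Defs where

open import Data.Nat using (ℕ; zero; suc; _+_; _*_; _∸_; _^_; _≤_; _<_; _≟_; _≤?_; NonZero)
open import Data.Nat.DivMod using (_%_; _/_)
open import Data.Fin using (Fin; toℕ; fromℕ)
open import Data.List using (List; map; upTo; allFin; filter; foldr)
open import Data.Nat.ListAction using (sum)
open import Data.Bool.ListAction using (any)
open import Data.Integer as ℤ using (ℤ; +_; -[1+_])
open import Data.Bool using (Bool; true; false; if_then_else_)
open import Relation.Nullary using (does)
open import Relation.Binary.PropositionalEquality using (_≡_)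

-- Elements of F_p are the naturals 0,…,p-1 (the list upTo p).
-- A polynomial of degree exactly d over F_p is a coefficient function
-- a : Fin (suc d) → ℕ with a i < p for all i and a (fromℕ d) ≠ 0
-- (the ≠ 0 condition is imposed in the statement).

half : ℕ → ℕ
half p = (p ∸ 1) / 2

sumℤ : List ℤ → ℤ
sumℤ = foldr ℤ._+_ (+ 0)

evalPoly : (p : ℕ) .{{_ : NonZero p}} {d : ℕ} → (Fin (suc d) → ℕ) → ℕ → ℕ
evalPoly p {d} a x = sum (map (λ i → a i * x ^ toℕ i) (allFin (suc d))) % p

isSquareMod : (p : ℕ) .{{_ : NonZero p}} → ℕ → Bool
isSquareMod p n = any (λ y → does ((y * y) % p ≟ n % p)) (upTo p)

legendre : (p : ℕ) .{{_ : NonZero p}} → ℕ → ℤ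
legendre p n =
  if does (n % p ≟ 0) then + 0
  else (if isSquareMod p n then + 1 else -[1+ 0 ])

subMod : (p : ℕ) .{{_ : NonZero p}} → ℕ → ℕ → ℕ
subMod p a γ = (a + (p ∸ γ)) % p

rγ : (p : ℕ) .{{_ : NonZero p}} {d : ℕ} → (Fin (suc d) → ℕ) → ℕ → ℤ
rγ p a γ =
  sumℤ (map (λ z → legendre p (subMod p z γ))
            (filter (λ z → evalPoly p a z ≟ 0) (upTo p)))
  ℤ.- sumℤ (map (λ x → (+ (evalPoly p a x ∸ 1)) ℤ.* legendre p (subMod p x γ))
                (filter (λ x → 1 ≤? evalPoly p a x) (upTo p)))

-- Write p = 2d + 1 and V x ∈ {0,…,p-1} for the value of P at x. The number N γ x of y with
-- y² + γ ≡ x is 1 + (x - γ / p), so r γ = Σ_x (1 - V x)(N γ x - 1) = p - T γ, where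
-- T γ = Σ_x V x · N γ x = Σ_y V (y² + γ). Since N γ x ≤ 2 and Σ_x V x = p, we get T γ ≤ 2p.
-- Modulo p, T γ ≡ Σ_y P(y² + γ); expanding (y² + γ)^i binomially, the power sums Σ_y y^k
-- vanish for k < p - 1 while Σ_y y^(p-1) ≡ -1 by Fermat, so only the leading coefficient
-- survives and T γ ≡ -c. Hence T γ + c ∈ {p, 2p}, i.e. r γ ∈ {c, c - p}. Finally
-- Σ_γ T γ = p², so Σ_γ r γ = 0, which forces r γ = c - p for exactly c values of γ.
module Submission where

open import Defs
open import Data.Nat using (ℕ; suc; _<_; _≤_; _∸_; NonZero)
open import Data.Nat.DivMod using (_%_)
open import Data.Nat.Primality using (Prime)
open import Data.Fin using (Fin; fromℕ)
open import Data.List using (map; upTo; filter; length)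
open import Data.Nat.ListAction using (sum)
open import Data.Integer as ℤ using (+_)
open import Data.Integer.Properties using () renaming (_≟_ to _≟ℤ_)
open import Relation.Binary.PropositionalEquality using (_≡_)
open import Data.Product using (_×_)

open import Data.Bool using (true; false; T; if_then_else_)
open import Data.Empty using (⊥)
open import Data.Fin using (zero; suc; toℕ; inject₁)
open import Data.Fin.Properties using (toℕ<n; toℕ-inject₁; toℕ-fromℕ)
open import Data.Integer using (ℤ; -[1+_])
open import Data.Integer.Properties as ℤP using (pos-+; pos-*)
import Data.Integer.Tactic.RingSolver as ℤ-Ring
open import Data.List using (List; []; _∷_; applyUpTo; tabulate)
open import Data.List.Membership.Propositional using (_∈_; find; lose)
open import Data.List.Membership.Propositional.Properties using (∈-upTo⁺; ∈-upTo⁻)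
open import Data.List.Properties using (map-cong; map-cong-local; length-upTo)
open import Data.List.Relation.Unary.All.Properties using (applyUpTo⁺₁)
open import Data.List.Relation.Unary.Any using (here; there)
open import Data.List.Relation.Unary.Any.Properties using (any⁺; any⁻)
open import Data.Nat
  using (zero; _+_; _*_; _^_; _!; _≟_; _≤?_; z≤n; s≤s; s≤s⁻¹; z<s; s<s; nonTrivial⇒n>1; nonTrivial⇒≢1)
open import Data.Nat.Combinatorics using (_C_; nCk≡n!/k![n-k]!; k![n∸k]!∣n!; nCk≡nC[n∸k]; nC1≡n; nCn≡1)
open import Data.Nat.DivMod
  using (_/_; m≡m%n+[m/n]*n; [m+kn]%n≡m%n; [m+n]%n≡m%n; m<n⇒m%n≡m; m%n<n; m/n*n≡m; %-distribˡ-+)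
open import Data.Nat.Divisibility
  using (_∣_; _∤_; divides; ∣m+n∣m⇒∣n; ∣m∣n⇒∣m+n; n∣m*n; m∣m*n; >⇒∤; ∣1⇒≡1; ∣n⇒∣m*n; ∣m⇒∣m*n; m%n≡0⇒n∣m)
open import Data.Nat.Induction using (<-rec)
open import Data.Nat.Primality using (euclidsLemma; prime⇒nonTrivial)
open import Data.Nat.Properties
open import Data.Nat.Tactic.RingSolver using (solve-∀)
open import Data.Product using (∃; ∃₂; _,_; proj₁; proj₂)
open import Data.Sum using (_⊎_; inj₁; inj₂; [_,_]′)
import Data.Sum as Sum
open import Data.Unit using (tt)
open import Data.Vec.Functional using (Vector)
open import Function using (_∘_; id)
open import Level using (0ℓ)
open import Relation.Binary.Bundles using (Setoid)
open import Relation.Binary.PropositionalEquality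
  using (_≢_; refl; sym; trans; cong; cong₂; subst; subst₂; module ≡-Reasoning)
open import Relation.Binary.Structures using (IsEquivalence)
open import Relation.Nullary using (does; yes; no; contradiction)
open import Relation.Nullary.Decidable using (dec-true; dec-false)
open import Relation.Unary using (Pred; Decidable)

open import Algebra.Properties.Semiring.Sum +-*-semiring
  using (sum-syntax; ∑-comm; ∑-distrib-+; *-distribˡ-sum; sum-cong-≗; sum-replicate-zero; sum-init-last)
  renaming (sum to ∑)
import Algebra.Properties.Monoid.Mult +-0-monoid as Mult
import Algebra.Properties.Semiring.Exp +-*-semiring as Exp
import Algebra.Properties.CommutativeSemiring.Binomial +-*-commutativeSemiring as Binomial

sumBelow : ℕ → (ℕ → ℕ) → ℕ
sumBelow n f = ∑[ i < n ] f (toℕ i)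

infixl 10 sumBelow
syntax sumBelow n (λ i → e) = ∑ℕ[ i < n ] e

sumBelow-cong : ∀ n {f g : ℕ → ℕ} → (∀ i → i < n → f i ≡ g i) → sumBelow n f ≡ sumBelow n g
sumBelow-cong n f≡g = sum-cong-≗ (λ i → f≡g (toℕ i) (toℕ<n i))

sumBelow-zero : ∀ n → ∑ℕ[ i < n ] 0 ≡ 0
sumBelow-zero n = sum-replicate-zero n

sumBelow-const : ∀ n c → ∑ℕ[ i < n ] c ≡ n * c
sumBelow-const zero    c = refl
sumBelow-const (suc n) c = cong (_+_ c) (sumBelow-const n c)

sumBelow-mono-≤ : ∀ n {f g : ℕ → ℕ} → (∀ i → i < n → f i ≤ g i) → sumBelow n f ≤ sumBelow n g
sumBelow-mono-≤ zero    f≤g = z≤n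
sumBelow-mono-≤ (suc n) f≤g = +-mono-≤ (f≤g 0 z<s) (sumBelow-mono-≤ n (λ i i<n → f≤g (suc i) (s<s i<n)))

sumBelow-comm : ∀ m n (f : ℕ → ℕ → ℕ) →
                ∑ℕ[ i < m ] ∑ℕ[ j < n ] f i j ≡ ∑ℕ[ j < n ] ∑ℕ[ i < m ] f i j
sumBelow-comm m n f = ∑-comm {m} {n} (λ i j → f (toℕ i) (toℕ j))

*-distribˡ-sumBelow : ∀ n c f → c * sumBelow n f ≡ ∑ℕ[ i < n ] (c * f i)
*-distribˡ-sumBelow n c f = *-distribˡ-sum {n} c (f ∘ toℕ)

sumBelow-suc : ∀ n f → sumBelow (suc n) f ≡ sumBelow n f + f n
sumBelow-suc zero    f = +-comm (f 0) 0
sumBelow-suc (suc n) f = trans (cong (_+_ (f 0)) (sumBelow-suc n (f ∘ suc))) (sym (+-assoc (f 0) _ _))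

sumBelow-shift : ∀ n f → sumBelow n (f ∘ suc) + f 0 ≡ sumBelow n f + f n
sumBelow-shift n f = trans (+-comm _ (f 0)) (sumBelow-suc n f)

sumBelow-periodic : ∀ n k (f : ℕ → ℕ) → (∀ i → f (n + i) ≡ f i) →
                    ∑ℕ[ i < n ] f (k + i) ≡ sumBelow n f
sumBelow-periodic n zero    f periodic = refl
sumBelow-periodic n (suc k) f periodic = trans shift-by-one (sumBelow-periodic n k f periodic)
  where
  g : ℕ → ℕ
  g i = f (k + i)
  wrap : g n ≡ g 0
  wrap = trans (cong f (+-comm k n)) (trans (periodic k) (cong f (sym (+-identityʳ k))))
  shift-by-one : ∑ℕ[ i < n ] f (suc k + i) ≡ sumBelow n g
  shift-by-one = +-cancelʳ-≡ (g 0) _ _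
    (trans (cong (_+ g 0) (sumBelow-cong n (λ i _ → cong f (sym (+-suc k i)))))
           (trans (sumBelow-shift n g) (cong (_+_ (sumBelow n g)) wrap)))

δ : ℕ → ℕ → ℕ
δ a b = if does (a ≟ b) then 1 else 0

δ-≡ : ∀ {a b} → a ≡ b → δ a b ≡ 1
δ-≡ {a} {b} a≡b = cong (λ t → if t then 1 else 0) (dec-true (a ≟ b) a≡b)

δ-≢ : ∀ {a b} → a ≢ b → δ a b ≡ 0
δ-≢ {a} {b} a≢b = cong (λ t → if t then 1 else 0) (dec-false (a ≟ b) a≢b)

δ-cong : ∀ {a b c e} → (a ≡ b → c ≡ e) → (c ≡ e → a ≡ b) → δ a b ≡ δ c e
δ-cong {a} {b} to from with a ≟ b
... | yes a≡b = trans (δ-≡ a≡b) (sym (δ-≡ (to a≡b)))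
... | no  a≢b = trans (δ-≢ a≢b) (sym (δ-≢ (a≢b ∘ from)))

sumBelow-δ : ∀ {u n} (F : ℕ → ℕ) → u < n → ∑ℕ[ x < n ] (δ u x * F x) ≡ F u
sumBelow-δ {zero}  {suc n} F _         = trans (cong₂ _+_ (*-identityˡ (F 0)) (sumBelow-zero n)) (+-identityʳ (F 0))
sumBelow-δ {suc u} {suc n} F (s<s u<n) = sumBelow-δ (F ∘ suc) u<n

sumBelow-δ-count : ∀ {u n} → u < n → ∑ℕ[ x < n ] δ u x ≡ 1
sumBelow-δ-count {u} {n} u<n =
  trans (sumBelow-cong n (λ x _ → sym (*-identityʳ (δ u x)))) (sumBelow-δ (λ _ → 1) u<n)

fibreSize : (ℕ → ℕ) → ℕ → ℕ → ℕ
fibreSize h n x = ∑ℕ[ y < n ] δ (h y) x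

sumBelow-fibres : ∀ {m} n (h : ℕ → ℕ) (F : ℕ → ℕ) → (∀ y → y < n → h y < m) →
                  ∑ℕ[ y < n ] F (h y) ≡ ∑ℕ[ x < m ] (F x * fibreSize h n x)
sumBelow-fibres {m} n h F h<m = begin
  ∑ℕ[ y < n ] F (h y)                        ≡⟨ sumBelow-cong n (λ y y<n → sumBelow-δ F (h<m y y<n)) ⟨
  ∑ℕ[ y < n ] ∑ℕ[ x < m ] (δ (h y) x * F x)  ≡⟨ sumBelow-comm n m (λ y x → δ (h y) x * F x) ⟩
  ∑ℕ[ x < m ] ∑ℕ[ y < n ] (δ (h y) x * F x)  ≡⟨ sumBelow-cong m (λ x _ → factor x) ⟩
  ∑ℕ[ x < m ] (F x * fibreSize h n x)        ∎
  where
  open ≡-Reasoning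
  factor : ∀ x → ∑ℕ[ y < n ] (δ (h y) x * F x) ≡ F x * fibreSize h n x
  factor x = trans (sumBelow-cong n (λ y _ → *-comm (δ (h y) x) (F x)))
                   (sym (*-distribˡ-sumBelow n (F x) (λ y → δ (h y) x)))

-- Congruences modulo n

-- Stated without subtraction, so that it is symmetric and cancellative on ℕ.
infix 4 _≈_mod_
_≈_mod_ : ℕ → ℕ → ℕ → Set
_≈_mod_ x y n = ∃₂ λ a b → x + a * n ≡ y + b * n

module _ {n : ℕ} where

  mod-reflexive : ∀ {x y} → x ≡ y → x ≈ y mod n
  mod-reflexive refl = 0 , 0 , refl

  mod-refl : ∀ {x} → x ≈ x mod n
  mod-refl = mod-reflexive refl

  mod-sym : ∀ {x y} → x ≈ y mod n → y ≈ x mod n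
  mod-sym (a , b , e) = b , a , sym e

  mod-trans : ∀ {x y z} → x ≈ y mod n → y ≈ z mod n → x ≈ z mod n
  mod-trans {x} {y} {z} (a , b , e) (c , d , f) = a + c , d + b , (begin
    x + (a + c) * n      ≡⟨ split x a c n ⟩
    x + a * n + c * n    ≡⟨ cong (_+ c * n) e ⟩
    y + b * n + c * n    ≡⟨ swap y b c n ⟩
    y + c * n + b * n    ≡⟨ cong (_+ b * n) f ⟩
    z + d * n + b * n    ≡⟨ split z d b n ⟨
    z + (d + b) * n      ∎)
    where
    open ≡-Reasoning
    split : ∀ x a c n → x + (a + c) * n ≡ x + a * n + c * n
    split = solve-∀
    swap : ∀ y b c n → y + b * n + c * n ≡ y + c * n + b * n
    swap = solve-∀

  mod-isEquivalence : IsEquivalence (_≈_mod n)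
  mod-isEquivalence = record { refl = mod-refl ; sym = mod-sym ; trans = mod-trans }

  +-cong-mod : ∀ {x x′ y y′} → x ≈ x′ mod n → y ≈ y′ mod n → x + y ≈ x′ + y′ mod n
  +-cong-mod {x} {x′} {y} {y′} (a , b , e) (c , d , f) = a + c , b + d , (begin
    x + y + (a + c) * n          ≡⟨ regroup x y a c n ⟩
    (x + a * n) + (y + c * n)    ≡⟨ cong₂ _+_ e f ⟩
    (x′ + b * n) + (y′ + d * n)  ≡⟨ regroup x′ y′ b d n ⟨
    x′ + y′ + (b + d) * n        ∎)
    where
    open ≡-Reasoning
    regroup : ∀ x y a c n → x + y + (a + c) * n ≡ (x + a * n) + (y + c * n)
    regroup = solve-∀

  *-congˡ-mod : ∀ k {x y} → x ≈ y mod n → k * x ≈ k * y mod n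
  *-congˡ-mod k {x} {y} (a , b , e) = k * a , k * b , (begin
    k * x + k * a * n   ≡⟨ factor k x a n ⟩
    k * (x + a * n)     ≡⟨ cong (k *_) e ⟩
    k * (y + b * n)     ≡⟨ factor k y b n ⟨
    k * y + k * b * n   ∎)
    where
    open ≡-Reasoning
    factor : ∀ k x a n → k * x + k * a * n ≡ k * (x + a * n)
    factor = solve-∀

  *-cong-mod : ∀ {x x′ y y′} → x ≈ x′ mod n → y ≈ y′ mod n → x * y ≈ x′ * y′ mod n
  *-cong-mod {x} {x′} {y} {y′} x≈x′ y≈y′ =
    mod-trans (subst₂ (_≈_mod n) (*-comm y x) (*-comm y x′) (*-congˡ-mod y x≈x′)) (*-congˡ-mod x′ y≈y′)

  ^-cong-mod : ∀ {x y} k → x ≈ y mod n → x ^ k ≈ y ^ k mod n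
  ^-cong-mod zero    x≈y = mod-refl
  ^-cong-mod (suc k) x≈y = *-cong-mod x≈y (^-cong-mod k x≈y)

  ∑-cong-mod : ∀ {m} {f g : Vector ℕ m} → (∀ i → f i ≈ g i mod n) → ∑ f ≈ ∑ g mod n
  ∑-cong-mod {zero}  f≈g = mod-refl
  ∑-cong-mod {suc m} f≈g = +-cong-mod (f≈g zero) (∑-cong-mod (f≈g ∘ suc))

  sumBelow-cong-mod : ∀ m {f g} → (∀ i → i < m → f i ≈ g i mod n) → sumBelow m f ≈ sumBelow m g mod n
  sumBelow-cong-mod m f≈g = ∑-cong-mod (λ i → f≈g (toℕ i) (toℕ<n i))

  +-cancelˡ-mod : ∀ k {x y} → k + x ≈ k + y mod n → x ≈ y mod n
  +-cancelˡ-mod k {x} {y} (a , b , e) =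
    a , b , +-cancelˡ-≡ k _ _ (trans (sym (+-assoc k x _)) (trans e (+-assoc k y _)))

  n≈0-mod : n ≈ 0 mod n
  n≈0-mod = 0 , 1 , trans (+-identityʳ n) (sym (+-identityʳ n))

  ∣⇒≈0-mod : ∀ {x} → n ∣ x → x ≈ 0 mod n
  ∣⇒≈0-mod {x} (divides q e) = 0 , q , trans (+-identityʳ x) e

  ≈0-mod⇒∣ : ∀ {x} → x ≈ 0 mod n → n ∣ x
  ≈0-mod⇒∣ {x} (a , b , e) = ∣m+n∣m⇒∣n (divides b (trans (+-comm (a * n) x) e)) (n∣m*n a)

  module _ .{{_ : NonZero n}} where

    %-≈-mod : ∀ x → x % n ≈ x mod n
    %-≈-mod x = x / n , 0 , trans (sym (m≡m%n+[m/n]*n x n)) (sym (+-identityʳ x))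

    %-≡⇒mod : ∀ {x y} → x % n ≡ y % n → x ≈ y mod n
    %-≡⇒mod {x} {y} eq = mod-trans (mod-sym (%-≈-mod x)) (mod-trans (mod-reflexive eq) (%-≈-mod y))

    mod⇒%-≡ : ∀ {x y} → x ≈ y mod n → x % n ≡ y % n
    mod⇒%-≡ {x} {y} (a , b , e) = trans (sym ([m+kn]%n≡m%n x a n)) (trans (cong (_% n) e) ([m+kn]%n≡m%n y b n))

mod-setoid : ℕ → Setoid 0ℓ 0ℓ
mod-setoid n = record { isEquivalence = mod-isEquivalence {n} }

module _ {n : ℕ} .{{_ : NonZero n}} where

  %-shift⁻ : ∀ {s γ x} → γ ≤ n → (s + γ) % n ≡ x → s % n ≡ (x + (n ∸ γ)) % n
  %-shift⁻ {s} {γ} {x} γ≤n s+γ≡x = mod⇒%-≡ (begin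
    s                      ≡⟨ +-identityʳ s ⟨
    s + 0                  ≈⟨ +-cong-mod mod-refl (mod-sym n≈0-mod) ⟩
    s + n                  ≡⟨ cong (_+_ s) (m+[n∸m]≡n γ≤n) ⟨
    s + (γ + (n ∸ γ))      ≡⟨ +-assoc s γ (n ∸ γ) ⟨
    s + γ + (n ∸ γ)        ≈⟨ +-cong-mod (mod-sym (%-≈-mod (s + γ))) mod-refl ⟩
    (s + γ) % n + (n ∸ γ)  ≡⟨ cong (_+ (n ∸ γ)) s+γ≡x ⟩
    x + (n ∸ γ)            ∎)
    where open import Relation.Binary.Reasoning.Setoid (mod-setoid n)

  %-shift⁺ : ∀ {s γ x} → γ ≤ n → x < n → s % n ≡ (x + (n ∸ γ)) % n → (s + γ) % n ≡ x
  %-shift⁺ {s} {γ} {x} γ≤n x<n s≡x-γ = trans (mod⇒%-≡ (begin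
    s + γ            ≈⟨ +-cong-mod (%-≡⇒mod s≡x-γ) mod-refl ⟩
    x + (n ∸ γ) + γ  ≡⟨ +-assoc x (n ∸ γ) γ ⟩
    x + (n ∸ γ + γ)  ≡⟨ cong (_+_ x) (m∸n+n≡m γ≤n) ⟩
    x + n            ≈⟨ +-cong-mod mod-refl n≈0-mod ⟩
    x + 0            ≡⟨ +-identityʳ x ⟩
    x                ∎)) (m<n⇒m%n≡m x<n)
    where open import Relation.Binary.Reasoning.Setoid (mod-setoid n)

square-negate : ∀ {n z} → z ≤ n → (n ∸ z) * (n ∸ z) ≈ z * z mod n
square-negate {n} {z} z≤n′ = z + z , n , subst (λ m → (n ∸ z) * (n ∸ z) + (z + z) * m ≡ z * z + m * m)
                                               (m∸n+n≡m z≤n′) (identity (n ∸ z) z)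
  where
  identity : ∀ w z → w * w + (z + z) * (w + z) ≡ z * z + (w + z) * (w + z)
  identity = solve-∀

∣∧<⇒≡0 : ∀ {p m} → p ∣ m → m < p → m ≡ 0
∣∧<⇒≡0 {m = zero}  _   _   = refl
∣∧<⇒≡0 {m = suc m} p∣m m<p = contradiction p∣m (>⇒∤ m<p)

∣∧<2*⇒≡0⊎≡ : ∀ {p m} → p ∣ m → m < p + p → m ≡ 0 ⊎ m ≡ p
∣∧<2*⇒≡0⊎≡ {p} (divides zero          m≡0)  _    = inj₁ m≡0
∣∧<2*⇒≡0⊎≡ {p} (divides (suc zero)    m≡p)  _    = inj₂ (trans m≡p (+-identityʳ p))
∣∧<2*⇒≡0⊎≡ {p} (divides (suc (suc q)) refl) m<2p =
  contradiction (+-monoʳ-≤ p (m≤m+n p (q * p))) (<⇒≱ m<2p)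

∣∧<3*⇒≡⊎≡2* : ∀ {p m} → p ∣ m → 0 < m → m < p + p + p → m ≡ p ⊎ m ≡ p + p
∣∧<3*⇒≡⊎≡2* {p} (divides zero refl) () _
∣∧<3*⇒≡⊎≡2* {p} (divides 1 refl) _ _ = inj₁ (+-identityʳ p)
∣∧<3*⇒≡⊎≡2* {p} (divides 2 refl) _ _ = inj₂ (cong (_+_ p) (+-identityʳ p))
∣∧<3*⇒≡⊎≡2* {p} (divides (suc (suc (suc q))) refl) _ m<3p =
  contradiction (subst (p + p + p ≤_) (expand p q) (m≤m+n (p + p + p) (q * p))) (<⇒≱ m<3p)
  where
  expand : ∀ p q → p + p + p + q * p ≡ suc (suc (suc q)) * p
  expand = solve-∀

double≢odd : ∀ z d → z + z ≢ suc (d + d)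
double≢odd zero    d       ()
double≢odd (suc z) zero    eq = m+1+n≢0 z (suc-injective eq)
double≢odd (suc z) (suc d) eq = double≢odd z d (suc-injective (trans (sym (+-suc z z))
                                   (trans (suc-injective eq) (cong suc (+-suc d d)))))

-- Binomial coefficients, Fermat's little theorem and power sums

×≡* : ∀ n x → n Mult.× x ≡ n * x
×≡* zero    x = refl
×≡* (suc n) x = cong (_+_ x) (×≡* n x)

^≡^ : ∀ x n → x Exp.^ n ≡ x ^ n
^≡^ x zero    = refl
^≡^ x (suc n) = cong (x *_) (^≡^ x n)

binomial-theorem : ∀ n x y → (x + y) ^ n ≡ ∑ℕ[ k < suc n ] ((n C k) * (x ^ k * y ^ (n ∸ k)))
binomial-theorem n x y = begin
  (x + y) ^ n                       ≡⟨ ^≡^ (x + y) n ⟨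
  (x + y) Exp.^ n                   ≡⟨ Binomial.theorem n x y ⟩
  Binomial.binomialExpansion x y n  ≡⟨ sumBelow-cong (suc n) (λ k _ → term k) ⟩
  ∑ℕ[ k < suc n ] ((n C k) * (x ^ k * y ^ (n ∸ k))) ∎
  where
  open ≡-Reasoning
  term : ∀ k → (n C k) Mult.× (x Exp.^ k * y Exp.^ (n ∸ k)) ≡ (n C k) * (x ^ k * y ^ (n ∸ k))
  term k = trans (×≡* (n C k) _) (cong₂ (λ u v → (n C k) * (u * v)) (^≡^ x k) (^≡^ y (n ∸ k)))

∣-∑ : ∀ {d m} {f : Vector ℕ m} → (∀ i → d ∣ f i) → d ∣ ∑ f
∣-∑ {m = zero}  d∣f = divides 0 refl
∣-∑ {m = suc m} d∣f = ∣m∣n⇒∣m+n (d∣f zero) (∣-∑ (d∣f ∘ suc))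

∣-sumBelow : ∀ {d} m {f} → (∀ i → i < m → d ∣ f i) → d ∣ sumBelow m f
∣-sumBelow m d∣f = ∣-∑ (λ i → d∣f (toℕ i) (toℕ<n i))

powerSum : ℕ → ℕ → ℕ
powerSum m e = ∑ℕ[ y < m ] (y ^ e)

-- Σ_y (y + 1)^(e+1) telescopes to Σ_y y^(e+1) + m^(e+1); expanding the left side gives the recurrence.
powerSum-recurrence : ∀ m e → ∑ℕ[ k < suc e ] ((suc e C k) * powerSum m k) ≡ m ^ suc e
powerSum-recurrence m e = +-cancelʳ-≡ (powerSum m (suc e)) _ _ (begin
  ∑ℕ[ k < suc e ] ((suc e C k) * powerSum m k) + powerSum m (suc e)
    ≡⟨ cong (_+_ (∑ℕ[ k < suc e ] ((suc e C k) * powerSum m k)))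
            (trans (cong (_* powerSum m (suc e)) (nCn≡1 (suc e))) (*-identityˡ _)) ⟨
  ∑ℕ[ k < suc e ] ((suc e C k) * powerSum m k) + (suc e C suc e) * powerSum m (suc e)
    ≡⟨ sumBelow-suc (suc e) (λ k → (suc e C k) * powerSum m k) ⟨
  ∑ℕ[ k < suc (suc e) ] ((suc e C k) * powerSum m k)
    ≡⟨ sumBelow-cong (suc (suc e)) (λ k _ → *-distribˡ-sumBelow m (suc e C k) (_^ k)) ⟩
  ∑ℕ[ k < suc (suc e) ] ∑ℕ[ y < m ] ((suc e C k) * y ^ k)
    ≡⟨ sumBelow-comm (suc (suc e)) m (λ k y → (suc e C k) * y ^ k) ⟩
  ∑ℕ[ y < m ] ∑ℕ[ k < suc (suc e) ] ((suc e C k) * y ^ k)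
    ≡⟨ sumBelow-cong m (λ y _ → sym (expand y)) ⟩
  ∑ℕ[ y < m ] (suc y ^ suc e)
    ≡⟨ +-identityʳ _ ⟨
  ∑ℕ[ y < m ] (suc y ^ suc e) + 0 ^ suc e
    ≡⟨ sumBelow-shift m (_^ suc e) ⟩
  powerSum m (suc e) + m ^ suc e
    ≡⟨ +-comm (powerSum m (suc e)) (m ^ suc e) ⟩
  m ^ suc e + powerSum m (suc e) ∎)
  where
  open ≡-Reasoning
  one-power : ∀ u k → u * 1 ^ k ≡ u
  one-power u k = trans (cong (u *_) (^-zeroˡ k)) (*-identityʳ u)
  expand : ∀ y → suc y ^ suc e ≡ ∑ℕ[ k < suc (suc e) ] ((suc e C k) * y ^ k)
  expand y = begin
    suc y ^ suc e
      ≡⟨ cong (_^ suc e) (+-comm 1 y) ⟩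
    (y + 1) ^ suc e
      ≡⟨ binomial-theorem (suc e) y 1 ⟩
    ∑ℕ[ k < suc (suc e) ] ((suc e C k) * (y ^ k * 1 ^ (suc e ∸ k)))
      ≡⟨ sumBelow-cong (suc (suc e)) (λ k _ → cong ((suc e C k) *_) (one-power (y ^ k) (suc e ∸ k))) ⟩
    ∑ℕ[ k < suc (suc e) ] ((suc e C k) * y ^ k) ∎

module _ {n : ℕ} (p-prime : Prime (suc n)) where

  private
    p : ℕ
    p = suc n

  prime∣*⇒∣ : ∀ {k m} → 0 < k → k < p → p ∣ k * m → p ∣ m
  prime∣*⇒∣ {suc _} _ k<p p∣km =
    [ (λ p∣k → contradiction p∣k (>⇒∤ k<p)) , id ]′ (euclidsLemma _ _ p-prime p∣km)

  prime∤! : ∀ {m} → m < p → p ∤ m !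
  prime∤! {zero}  _   p∣1  = nonTrivial⇒≢1 {{prime⇒nonTrivial p-prime}} (∣1⇒≡1 p∣1)
  prime∤! {suc m} m<p p∣m! = prime∤! (<-trans (n<1+n m) m<p) (prime∣*⇒∣ z<s m<p p∣m!)

  prime∣C : ∀ {k} → 0 < k → k < p → p ∣ p C k
  prime∣C {k} 0<k k<p = [ id , (λ p∣k![p-k]! → contradiction p∣k![p-k]! ∤k![p-k]!) ]′
                          (euclidsLemma (p C k) (k ! * (p ∸ k) !) p-prime p∣p!)
    where
    instance
      _ : NonZero (k ! * (p ∸ k) !)
      _ = k !* (p ∸ k) !≢0
    p∣p! : p ∣ (p C k) * (k ! * (p ∸ k) !)
    p∣p! = subst (p ∣_) (sym (trans (cong (_* (k ! * (p ∸ k) !)) (nCk≡n!/k![n-k]! (<⇒≤ k<p)))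
                                    (m/n*n≡m (k![n∸k]!∣n! (<⇒≤ k<p)))))
                 (m∣m*n (n !))
    ∤k![p-k]! : p ∤ k ! * (p ∸ k) !
    ∤k![p-k]! p∣ =
      [ prime∤! k<p , prime∤! (∸-monoʳ-< 0<k (<⇒≤ k<p)) ]′ (euclidsLemma (k !) ((p ∸ k) !) p-prime p∣)

  fermat : ∀ y → y ^ p ≈ y mod p
  fermat zero    = mod-refl
  fermat (suc y) = begin
    suc y ^ p                                     ≡⟨ cong (_^ p) (+-comm 1 y) ⟩
    (y + 1) ^ p                                   ≡⟨ binomial-theorem p y 1 ⟩
    term 0 + ∑ℕ[ k < p ] term (suc k)             ≡⟨ cong (_+_ (term 0)) (sumBelow-suc n (term ∘ suc)) ⟩
    term 0 + (∑ℕ[ k < n ] term (suc k) + term p)  ≈⟨ +-cong-mod (mod-reflexive first) (+-cong-mod (∣⇒≈0-mod middle) last) ⟩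
    1 + (0 + y)                                   ∎
    where
    open import Relation.Binary.Reasoning.Setoid (mod-setoid p)
    term : ℕ → ℕ
    term k = (p C k) * (y ^ k * 1 ^ (p ∸ k))
    first : term 0 ≡ 1
    first = trans (*-identityˡ _) (trans (+-identityʳ _) (^-zeroˡ p))
    last : term p ≈ y mod p
    last = mod-trans (mod-reflexive (trans (cong₂ (λ c t → c * (y ^ p * 1 ^ t)) (nCn≡1 p) (n∸n≡0 n))
                                           (trans (*-identityˡ _) (*-identityʳ _))))
                     (fermat y)
    middle : p ∣ ∑ℕ[ k < n ] term (suc k)
    middle = ∣-sumBelow n {term ∘ suc} (λ k k<n → ∣m⇒∣m*n _ (prime∣C z<s (s<s k<n)))

  fermat-little : ∀ {y} → 0 < y → y < p → y ^ n ≈ 1 mod p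
  fermat-little {y} 0<y y<p with y ^ n in y^n≡
  ... | zero  = contradiction (m^n≡0⇒m≡0 y n y^n≡) (>⇒≢ 0<y)
  ... | suc w = +-cong-mod (mod-refl {x = 1}) (∣⇒≈0-mod (prime∣*⇒∣ 0<y y<p (≈0-mod⇒∣ yw≈0)))
    where
    open import Relation.Binary.Reasoning.Setoid (mod-setoid p)
    yw≈0 : y * w ≈ 0 mod p
    yw≈0 = +-cancelˡ-mod y (begin
      y + y * w  ≡⟨ *-suc y w ⟨
      y * suc w  ≡⟨ cong (y *_) y^n≡ ⟨
      y ^ p      ≈⟨ fermat y ⟩
      y          ≡⟨ +-identityʳ y ⟨
      y + 0      ∎)

  prime∣powerSum : ∀ {e} → e < n → p ∣ powerSum p e
  prime∣powerSum {e} = <-rec (λ e → e < n → p ∣ powerSum p e) step e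
    where
    step : ∀ e → (∀ {k} → k < e → k < n → p ∣ powerSum p k) → e < n → p ∣ powerSum p e
    step e rec e<n = prime∣*⇒∣ z<s (s<s e<n) (subst (λ c → p ∣ c * powerSum p e) C[1+e,e]≡1+e p∣top)
      where
      lower : p ∣ ∑ℕ[ k < e ] ((suc e C k) * powerSum p k)
      lower = ∣-sumBelow e {λ k → (suc e C k) * powerSum p k}
                (λ k k<e → ∣n⇒∣m*n (suc e C k) (rec k<e (<-trans k<e e<n)))
      p∣all : p ∣ ∑ℕ[ k < e ] ((suc e C k) * powerSum p k) + (suc e C e) * powerSum p e
      p∣all = subst (p ∣_) (trans (sym (powerSum-recurrence p e))
                                  (sumBelow-suc e (λ k → (suc e C k) * powerSum p k)))
                    (m∣m*n (p ^ e))
      p∣top : p ∣ (suc e C e) * powerSum p e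
      p∣top = ∣m+n∣m⇒∣n p∣all lower
      C[1+e,e]≡1+e : suc e C e ≡ suc e
      C[1+e,e]≡1+e = trans (nCk≡nC[n∸k] (n≤1+n e))
                           (trans (cong (suc e C_) (m+n∸n≡m 1 e)) (nC1≡n (suc e)))

  powerSum-top : powerSum p n + 1 ≈ 0 mod p
  powerSum-top = begin
    powerSum p n + 1                     ≡⟨⟩
    0 ^ n + ∑ℕ[ y < n ] (suc y ^ n) + 1  ≈⟨ +-cong-mod (+-cong-mod (mod-reflexive (0^n≡0 0<n))
                                              (sumBelow-cong-mod n (λ y y<n → fermat-little z<s (s<s y<n))))
                                              mod-refl ⟩
    0 + ∑ℕ[ y < n ] 1 + 1                ≡⟨ cong (_+ 1) (trans (sumBelow-const n 1) (*-identityʳ n)) ⟩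
    n + 1                                ≡⟨ +-comm n 1 ⟩
    p                                    ≈⟨ n≈0-mod ⟩
    0                                    ∎
    where
    open import Relation.Binary.Reasoning.Setoid (mod-setoid p)
    0<n : 0 < n
    0<n = s≤s⁻¹ (nonTrivial⇒n>1 p {{prime⇒nonTrivial p-prime}})
    0^n≡0 : ∀ {k} → 0 < k → 0 ^ k ≡ 0
    0^n≡0 {suc k} _ = refl

-- Summing a polynomial along the parabola y² + γ

square^ : ∀ y j → (y * y) ^ j ≡ y ^ (j + j)
square^ y zero    = refl
square^ y (suc j) = begin
  y * y * (y * y) ^ j    ≡⟨ cong (y * y *_) (square^ y j) ⟩
  y * y * y ^ (j + j)    ≡⟨ *-assoc y y _ ⟩
  y * (y * y ^ (j + j))  ≡⟨ cong (λ k → y * y ^ k) (+-suc j j) ⟨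
  y ^ (suc j + suc j)    ∎
  where open ≡-Reasoning

sum-parabola^ : ∀ m γ i →
  ∑ℕ[ y < m ] ((y * y + γ) ^ i) ≡ ∑ℕ[ j < suc i ] ((i C j) * γ ^ (i ∸ j) * powerSum m (j + j))
sum-parabola^ m γ i = begin
  ∑ℕ[ y < m ] ((y * y + γ) ^ i)
    ≡⟨ sumBelow-cong m (λ y _ → trans (binomial-theorem i (y * y) γ) (sumBelow-cong (suc i) (λ j _ → term y j))) ⟩
  ∑ℕ[ y < m ] ∑ℕ[ j < suc i ] ((i C j) * γ ^ (i ∸ j) * y ^ (j + j))
    ≡⟨ sumBelow-comm m (suc i) (λ y j → (i C j) * γ ^ (i ∸ j) * y ^ (j + j)) ⟩
  ∑ℕ[ j < suc i ] ∑ℕ[ y < m ] ((i C j) * γ ^ (i ∸ j) * y ^ (j + j))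
    ≡⟨ sumBelow-cong (suc i) (λ j _ → *-distribˡ-sumBelow m ((i C j) * γ ^ (i ∸ j)) (_^ (j + j))) ⟨
  ∑ℕ[ j < suc i ] ((i C j) * γ ^ (i ∸ j) * powerSum m (j + j)) ∎
  where
  open ≡-Reasoning
  rearrange : ∀ c u v → c * (u * v) ≡ c * v * u
  rearrange = solve-∀
  term : ∀ y j → (i C j) * ((y * y) ^ j * γ ^ (i ∸ j)) ≡ (i C j) * γ ^ (i ∸ j) * y ^ (j + j)
  term y j = trans (rearrange (i C j) _ _) (cong ((i C j) * γ ^ (i ∸ j) *_) (square^ y j))

evalℕ : ∀ {d} → (Fin (suc d) → ℕ) → ℕ → ℕ
evalℕ {d} a x = ∑[ i < suc d ] (a i * x ^ toℕ i)

evalℕ-cong-mod : ∀ {n d} (a : Fin (suc d) → ℕ) {x y} → x ≈ y mod n → evalℕ a x ≈ evalℕ a y mod n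
evalℕ-cong-mod a x≈y = ∑-cong-mod (λ i → *-congˡ-mod (a i) (^-cong-mod (toℕ i) x≈y))

module _ {d : ℕ} (p-prime : Prime (suc (d + d))) where

  private
    p : ℕ
    p = suc (d + d)

  prime∣sum-parabola^ : ∀ γ {i} → i < d → p ∣ ∑ℕ[ y < p ] ((y * y + γ) ^ i)
  prime∣sum-parabola^ γ {i} i<d = subst (p ∣_) (sym (sum-parabola^ p γ i))
    (∣-sumBelow (suc i) {λ j → (i C j) * γ ^ (i ∸ j) * powerSum p (j + j)}
      (λ j j≤i → let j<d = ≤-<-trans (s≤s⁻¹ j≤i) i<d in
                 ∣n⇒∣m*n ((i C j) * γ ^ (i ∸ j)) (prime∣powerSum p-prime (+-mono-< j<d j<d))))

  sum-parabola^-top : ∀ γ → ∑ℕ[ y < p ] ((y * y + γ) ^ d) + 1 ≈ 0 mod p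
  sum-parabola^-top γ = begin
    ∑ℕ[ y < p ] ((y * y + γ) ^ d) + 1
      ≡⟨ cong (_+ 1) (trans (sum-parabola^ p γ d) (sumBelow-suc d c)) ⟩
    ∑ℕ[ j < d ] c j + c d + 1
      ≈⟨ +-cong-mod (+-cong-mod (∣⇒≈0-mod lower) (mod-reflexive top)) mod-refl ⟩
    0 + powerSum p (d + d) + 1
      ≈⟨ powerSum-top p-prime ⟩
    0 ∎
    where
    open import Relation.Binary.Reasoning.Setoid (mod-setoid p)
    c : ℕ → ℕ
    c j = (d C j) * γ ^ (d ∸ j) * powerSum p (j + j)
    lower : p ∣ ∑ℕ[ j < d ] c j
    lower = ∣-sumBelow d {c} (λ j j<d →
              ∣n⇒∣m*n ((d C j) * γ ^ (d ∸ j)) (prime∣powerSum p-prime (+-mono-< j<d j<d)))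
    top : c d ≡ powerSum p (d + d)
    top = trans (cong₂ (λ (u v : ℕ) → u * γ ^ v * powerSum p (d + d)) (nCn≡1 d) (n∸n≡0 d)) (*-identityˡ _)

  sum-evalℕ-parabola : ∀ (a : Fin (suc d) → ℕ) γ →
                          ∑ℕ[ y < p ] evalℕ a (y * y + γ) + a (fromℕ d) ≈ 0 mod p
  sum-evalℕ-parabola a γ = begin
    ∑ℕ[ y < p ] evalℕ a (y * y + γ) + a (fromℕ d)
      ≡⟨ cong (_+ a (fromℕ d)) (trans swap (sum-init-last {d} (λ i → a i * X (toℕ i)))) ⟩
    ∑[ i < d ] (a (inject₁ i) * X (toℕ (inject₁ i))) + a (fromℕ d) * X (toℕ (fromℕ d)) + a (fromℕ d)
      ≈⟨ +-cong-mod (+-cong-mod (∣⇒≈0-mod lower) (mod-reflexive (cong (λ k → a (fromℕ d) * X k) (toℕ-fromℕ d))))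
                    mod-refl ⟩
    0 + a (fromℕ d) * X d + a (fromℕ d)
      ≡⟨ trans (cong (_+_ (a (fromℕ d) * X d)) (sym (*-identityʳ (a (fromℕ d)))))
               (sym (*-distribˡ-+ (a (fromℕ d)) (X d) 1)) ⟩
    a (fromℕ d) * (X d + 1)
      ≈⟨ *-congˡ-mod (a (fromℕ d)) (sum-parabola^-top γ) ⟩
    a (fromℕ d) * 0
      ≡⟨ *-zeroʳ (a (fromℕ d)) ⟩
    0 ∎
    where
    open import Relation.Binary.Reasoning.Setoid (mod-setoid p)
    X : ℕ → ℕ
    X i = ∑ℕ[ y < p ] ((y * y + γ) ^ i)
    swap : ∑ℕ[ y < p ] evalℕ a (y * y + γ) ≡ ∑[ i < suc d ] (a i * X (toℕ i))
    swap = trans (∑-comm {p} {suc d} (λ y i → a i * (toℕ y * toℕ y + γ) ^ toℕ i))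
                 (sum-cong-≗ (λ i → sym (*-distribˡ-sum {p} (a i) (λ y → (toℕ y * toℕ y + γ) ^ toℕ i))))
    lower : p ∣ ∑[ i < d ] (a (inject₁ i) * X (toℕ (inject₁ i)))
    lower = ∣-∑ (λ i → ∣n⇒∣m*n (a (inject₁ i))
                  (subst (λ k → p ∣ X k) (sym (toℕ-inject₁ i)) (prime∣sum-parabola^ γ (toℕ<n i))))

-- Square roots modulo p and the Legendre symbol

rootCount : (p : ℕ) .{{_ : NonZero p}} → ℕ → ℕ
rootCount p t = fibreSize (λ y → (y * y) % p) p t

legendre≤1 : ∀ p .{{_ : NonZero p}} t → legendre p t ℤ.≤ + 1
legendre≤1 p t = bound (does (t % p ≟ 0)) (isSquareMod p t)
  where
  bound : ∀ b s → (if b then + 0 else (if s then + 1 else -[1+ 0 ])) ℤ.≤ + 1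
  bound true  _     = ℤ.+≤+ z≤n
  bound false true  = ℤ.+≤+ ≤-refl
  bound false false = ℤ.-≤+

module _ {d : ℕ} (p-prime : Prime (suc (d + d))) where

  private
    p : ℕ
    p = suc (d + d)

  square≡0⇒≡0 : ∀ {y} → y < p → (y * y) % p ≡ 0 → y ≡ 0
  square≡0⇒≡0 {y} y<p y²≡0 =
    ∣∧<⇒≡0 ([ id , id ]′ (euclidsLemma y y p-prime (m%n≡0⇒n∣m _ p y²≡0))) y<p

  private
    squares-≡-≤ : ∀ {y z} → z ≤ y → y < p → (y * y) % p ≡ (z * z) % p → y ≡ z ⊎ y + z ≡ p
    squares-≡-≤ {y} {z} z≤y y<p eq = [ k-case , sum-case ]′ (euclidsLemma k (y + z) p-prime p∣k[y+z])
      where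
      k : ℕ
      k = y ∸ z
      y≡z+k : y ≡ z + k
      y≡z+k = sym (m+[n∸m]≡n z≤y)
      identity : ∀ z k → (z + k) * (z + k) ≡ z * z + k * ((z + k) + z)
      identity = solve-∀
      expand : y * y ≡ z * z + k * (y + z)
      expand = trans (cong (λ w → w * w) y≡z+k)
                     (trans (identity z k) (cong (λ w → z * z + k * (w + z)) (sym y≡z+k)))
      p∣k[y+z] : p ∣ k * (y + z)
      p∣k[y+z] = ≈0-mod⇒∣ (+-cancelˡ-mod (z * z) (begin
        z * z + k * (y + z)  ≡⟨ expand ⟨
        y * y                ≈⟨ %-≡⇒mod eq ⟩
        z * z                ≡⟨ +-identityʳ (z * z) ⟨
        z * z + 0            ∎))
        where open import Relation.Binary.Reasoning.Setoid (mod-setoid p)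
      k-case : p ∣ k → y ≡ z ⊎ y + z ≡ p
      k-case p∣k = inj₁ (trans y≡z+k
        (trans (cong (_+_ z) (∣∧<⇒≡0 p∣k (≤-<-trans (m∸n≤m y z) y<p))) (+-identityʳ z)))
      sum-case : p ∣ y + z → y ≡ z ⊎ y + z ≡ p
      sum-case p∣y+z with ∣∧<2*⇒≡0⊎≡ p∣y+z (+-mono-<-≤ y<p (≤-trans z≤y (<⇒≤ y<p)))
      ... | inj₁ y+z≡0 = inj₁ (trans (m+n≡0⇒m≡0 y y+z≡0) (sym (m+n≡0⇒n≡0 y y+z≡0)))
      ... | inj₂ y+z≡p = inj₂ y+z≡p

  squares-≡ : ∀ {y z} → y < p → z < p → (y * y) % p ≡ (z * z) % p → y ≡ z ⊎ y + z ≡ p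
  squares-≡ {y} {z} y<p z<p eq with ≤-total z y
  ... | inj₁ z≤y = squares-≡-≤ z≤y y<p eq
  ... | inj₂ y≤z = Sum.map sym (trans (+-comm y z)) (squares-≡-≤ y≤z z<p (sym eq))

  rootCount-0 : rootCount p 0 ≡ 1
  rootCount-0 = trans (sumBelow-cong p (λ y y<p → δ-cong (sym ∘ square≡0⇒≡0 y<p) (λ { refl → refl })))
                      (sumBelow-δ-count {n = p} z<s)

  rootCount-nonSquare : ∀ {t} → t < p → isSquareMod p t ≡ false → rootCount p t ≡ 0
  rootCount-nonSquare {t} t<p nonSquare =
    trans (sumBelow-cong p (λ y y<p → δ-≢ (λ y²≡t → isSquare y<p y²≡t))) (sumBelow-zero p)
    where
    isSquare : ∀ {y} → y < p → (y * y) % p ≡ t → ⊥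
    isSquare y<p y²≡t = subst T nonSquare
      (any⁺ _ (lose (∈-upTo⁺ y<p) (≡⇒≡ᵇ _ _ (trans y²≡t (sym (m<n⇒m%n≡m t<p))))))

  rootCount-square : ∀ {t} → 0 < t → t < p → isSquareMod p t ≡ true → rootCount p t ≡ 2
  rootCount-square {t} 0<t t<p square = begin
    ∑ℕ[ y < p ] δ ((y * y) % p) t        ≡⟨ sumBelow-cong p (λ y y<p → split y<p) ⟩
    ∑ℕ[ y < p ] (δ y₀ y + δ (p ∸ y₀) y)  ≡⟨ ∑-distrib-+ {p} (δ y₀ ∘ toℕ) (δ (p ∸ y₀) ∘ toℕ) ⟩
    ∑ℕ[ y < p ] δ y₀ y + ∑ℕ[ y < p ] δ (p ∸ y₀) y
      ≡⟨ cong₂ _+_ (sumBelow-δ-count y₀<p) (sumBelow-δ-count (∸-monoʳ-< 0<y₀ (<⇒≤ y₀<p))) ⟩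
    2                                    ∎
    where
    open ≡-Reasoning
    witness : ∃ λ y → y ∈ upTo p × T (does ((y * y) % p ≟ t % p))
    witness = find (any⁻ _ (upTo p) (subst T (sym square) tt))
    y₀ : ℕ
    y₀ = proj₁ witness
    y₀<p : y₀ < p
    y₀<p = ∈-upTo⁻ (proj₁ (proj₂ witness))
    y₀²≡t : (y₀ * y₀) % p ≡ t
    y₀²≡t = trans (≡ᵇ⇒≡ _ _ (proj₂ (proj₂ witness))) (m<n⇒m%n≡m t<p)
    0<y₀ : 0 < y₀
    0<y₀ with y₀ | y₀²≡t
    ... | zero  | 0≡t = contradiction (sym 0≡t) (>⇒≢ 0<t)
    ... | suc _ | _   = z<s
    y₀≢p-y₀ : y₀ ≢ p ∸ y₀
    y₀≢p-y₀ y₀≡p-y₀ = double≢odd y₀ d (trans (cong (_+_ y₀) y₀≡p-y₀) (m+[n∸m]≡n (<⇒≤ y₀<p)))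
    root₁ : ∀ {y} → y₀ ≡ y → (y * y) % p ≡ t
    root₁ refl = y₀²≡t
    root₂ : ∀ {y} → p ∸ y₀ ≡ y → (y * y) % p ≡ t
    root₂ refl = trans (mod⇒%-≡ (square-negate (<⇒≤ y₀<p))) y₀²≡t
    split : ∀ {y} → y < p → δ ((y * y) % p) t ≡ δ y₀ y + δ (p ∸ y₀) y
    split {y} y<p with (y * y) % p ≟ t
    ... | no y²≢t = trans (δ-≢ y²≢t) (sym (cong₂ _+_ (δ-≢ {y₀} (y²≢t ∘ root₁)) (δ-≢ {p ∸ y₀} (y²≢t ∘ root₂))))
    ... | yes y²≡t with squares-≡ y<p y₀<p (trans y²≡t (sym y₀²≡t))
    ...   | inj₁ refl   = trans (δ-≡ y²≡t) (sym (cong₂ _+_ (δ-≡ {y₀} refl) (δ-≢ {p ∸ y₀} (y₀≢p-y₀ ∘ sym))))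
    ...   | inj₂ y+y₀≡p = trans (δ-≡ y²≡t) (sym (cong₂ _+_ (δ-≢ {y₀} (λ y₀≡y → y₀≢p-y₀ (trans y₀≡y y≡p-y₀)))
                                                        (δ-≡ {p ∸ y₀} (sym y≡p-y₀))))
      where
      y≡p-y₀ : y ≡ p ∸ y₀
      y≡p-y₀ = trans (sym (m+n∸n≡m y y₀)) (cong (_∸ y₀) y+y₀≡p)

  legendre-unit : ∀ {t} → 0 < t → t < p → legendre p t ≡ (if isSquareMod p t then + 1 else -[1+ 0 ])
  legendre-unit {t} 0<t t<p =
    cong (λ b → if b then + 0 else (if isSquareMod p t then + 1 else -[1+ 0 ]))
         (dec-false (t % p ≟ 0) (λ t%p≡0 → >⇒≢ 0<t (trans (sym (m<n⇒m%n≡m t<p)) t%p≡0)))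

  legendre≡rootCount-1 : ∀ {t} → t < p → legendre p t ≡ + rootCount p t ℤ.- + 1
  legendre≡rootCount-1 {zero}  _   = cong (λ r → + r ℤ.- + 1) (sym rootCount-0)
  legendre≡rootCount-1 {suc t} t<p = by-cases (isSquareMod p (suc t)) refl
    where
    unit : ∀ {b} → isSquareMod p (suc t) ≡ b → legendre p (suc t) ≡ (if b then + 1 else -[1+ 0 ])
    unit sq = trans (legendre-unit z<s t<p) (cong (λ b → if b then + 1 else -[1+ 0 ]) sq)
    by-cases : ∀ b → isSquareMod p (suc t) ≡ b → legendre p (suc t) ≡ + rootCount p (suc t) ℤ.- + 1
    by-cases true  sq = trans (unit sq) (cong (λ r → + r ℤ.- + 1) (sym (rootCount-square z<s t<p sq)))
    by-cases false sq = trans (unit sq) (cong (λ r → + r ℤ.- + 1) (sym (rootCount-nonSquare t<p sq)))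

sum-map-applyUpTo : ∀ n (h f : ℕ → ℕ) → sum (map f (applyUpTo h n)) ≡ ∑ℕ[ i < n ] f (h i)
sum-map-applyUpTo zero    h f = refl
sum-map-applyUpTo (suc n) h f = cong (_+_ (f (h 0))) (sum-map-applyUpTo n (h ∘ suc) f)

sum-map-upTo : ∀ n (f : ℕ → ℕ) → sum (map f (upTo n)) ≡ sumBelow n f
sum-map-upTo n = sum-map-applyUpTo n id

sum-map-tabulate : ∀ {A : Set} n (g : Fin n → A) (f : A → ℕ) → sum (map f (tabulate g)) ≡ ∑[ i < n ] f (g i)
sum-map-tabulate zero    g f = refl
sum-map-tabulate (suc n) g f = cong (_+_ (f (g zero))) (sum-map-tabulate n (g ∘ suc) f)

map-cong-upTo : ∀ {A : Set} {f g : ℕ → A} n → (∀ {i} → i < n → f i ≡ g i) → map f (upTo n) ≡ map g (upTo n)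
map-cong-upTo n f≡g = map-cong-local (applyUpTo⁺₁ id n f≡g)

sumℤ-map-+ : ∀ {A : Set} (f : A → ℕ) xs → sumℤ (map (λ x → + f x) xs) ≡ + sum (map f xs)
sumℤ-map-+ f []       = refl
sumℤ-map-+ f (x ∷ xs) = trans (cong (ℤ._+_ (+ f x)) (sumℤ-map-+ f xs)) (sym (pos-+ (f x) _))

sumℤ-map-- : ∀ {A : Set} (f h : A → ℤ) xs →
             sumℤ (map (λ x → f x ℤ.- h x) xs) ≡ sumℤ (map f xs) ℤ.- sumℤ (map h xs)
sumℤ-map-- f h []       = refl
sumℤ-map-- f h (x ∷ xs) = trans (cong (ℤ._+_ (f x ℤ.- h x)) (sumℤ-map-- f h xs)) (regroup (f x) (h x) _ _)
  where
  regroup : ∀ a b c e → (a ℤ.- b) ℤ.+ (c ℤ.- e) ≡ (a ℤ.+ c) ℤ.- (b ℤ.+ e)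
  regroup = ℤ-Ring.solve-∀

sumℤ-map-⊖ : ∀ {A : Set} (f g : A → ℕ) xs →
             sumℤ (map (λ x → + f x ℤ.- + g x) xs) ≡ + sum (map f xs) ℤ.- + sum (map g xs)
sumℤ-map-⊖ f g xs =
  trans (sumℤ-map-- (λ x → + f x) (λ x → + g x) xs) (cong₂ ℤ._-_ (sumℤ-map-+ f xs) (sumℤ-map-+ g xs))

sumℤ-filter : ∀ {A : Set} {P : Pred A 0ℓ} (P? : Decidable P) (g : A → ℤ) xs →
              sumℤ (map g (filter P? xs)) ≡ sumℤ (map (λ x → if does (P? x) then g x else + 0) xs)
sumℤ-filter P? g []       = refl
sumℤ-filter P? g (x ∷ xs) with does (P? x)
... | true  = cong (ℤ._+_ (g x)) (sumℤ-filter P? g xs)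
... | false = trans (sumℤ-filter P? g xs) (sym (ℤP.+-identityˡ _))

sumℤ-filter-split : ∀ {A : Set} (V : A → ℕ) (g : A → ℤ) xs →
  sumℤ (map g (filter (λ x → V x ≟ 0) xs)) ℤ.- sumℤ (map (λ x → + (V x ∸ 1) ℤ.* g x) (filter (λ x → 1 ≤? V x) xs))
    ≡ sumℤ (map (λ x → (+ 1 ℤ.- + V x) ℤ.* g x) xs)
sumℤ-filter-split {A} V g xs = begin
  sumℤ (map g (filter (λ x → V x ≟ 0) xs)) ℤ.- sumℤ (map (λ x → + (V x ∸ 1) ℤ.* g x) (filter (λ x → 1 ≤? V x) xs))
    ≡⟨ cong₂ ℤ._-_ (sumℤ-filter (λ x → V x ≟ 0) g xs) (sumℤ-filter (λ x → 1 ≤? V x) (λ x → + (V x ∸ 1) ℤ.* g x) xs) ⟩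
  sumℤ (map zero-part xs) ℤ.- sumℤ (map positive-part xs)
    ≡⟨ sumℤ-map-- zero-part positive-part xs ⟨
  sumℤ (map (λ x → zero-part x ℤ.- positive-part x) xs)
    ≡⟨ cong sumℤ (map-cong (λ x → pointwise (V x) (g x)) xs) ⟩
  sumℤ (map (λ x → (+ 1 ℤ.- + V x) ℤ.* g x) xs) ∎
  where
  open ≡-Reasoning
  zero-part positive-part : A → ℤ
  zero-part     x = if does (V x ≟ 0) then g x else + 0
  positive-part x = if does (1 ≤? V x) then + (V x ∸ 1) ℤ.* g x else + 0
  pointwise : ∀ v u → (if does (v ≟ 0) then u else + 0) ℤ.- (if does (1 ≤? v) then + (v ∸ 1) ℤ.* u else + 0)
                        ≡ (+ 1 ℤ.- + v) ℤ.* u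
  pointwise zero    u = zero-case u
    where
    zero-case : ∀ u → u ℤ.- + 0 ≡ (+ 1 ℤ.- + 0) ℤ.* u
    zero-case = ℤ-Ring.solve-∀
  pointwise (suc k) u = trans (suc-case u (+ k)) (cong (λ m → (+ 1 ℤ.- m) ℤ.* u) (sym (pos-+ 1 k)))
    where
    suc-case : ∀ u k → + 0 ℤ.- k ℤ.* u ≡ (+ 1 ℤ.- (+ 1 ℤ.+ k)) ℤ.* u
    suc-case = ℤ-Ring.solve-∀

module TwoValuedCount {A : Set} (r : A → ℤ) {u v : ℤ} (u≢v : u ≢ v) where

  count : ℤ → List A → ℕ
  count w xs = length (filter (λ x → r x ≟ℤ w) xs)

  TwoValued : List A → Set
  TwoValued xs = ∀ {x} → x ∈ xs → r x ≡ u ⊎ r x ≡ v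

  count-two-valued : ∀ xs → TwoValued xs → count u xs + count v xs ≡ length xs
  count-two-valued []       _         = refl
  count-two-valued (x ∷ xs) twoValued with r x ≟ℤ u | r x ≟ℤ v | count-two-valued xs (twoValued ∘ there)
  ... | yes rx≡u | yes rx≡v | _  = contradiction (trans (sym rx≡u) rx≡v) u≢v
  ... | yes _    | no _     | ih = cong suc ih
  ... | no _     | yes _    | ih = trans (+-suc _ _) (cong suc ih)
  ... | no rx≢u  | no rx≢v  | _  with twoValued (here refl)
  ...   | inj₁ rx≡u = contradiction rx≡u rx≢u
  ...   | inj₂ rx≡v = contradiction rx≡v rx≢v

  sumℤ-two-valued : ∀ xs → TwoValued xs → sumℤ (map r xs) ≡ + count u xs ℤ.* u ℤ.+ + count v xs ℤ.* v
  sumℤ-two-valued []       _         = refl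
  sumℤ-two-valued (x ∷ xs) twoValued with r x ≟ℤ u | r x ≟ℤ v | sumℤ-two-valued xs (twoValued ∘ there)
  ... | yes rx≡u | yes rx≡v | _  = contradiction (trans (sym rx≡u) rx≡v) u≢v
  ... | yes rx≡u | no _     | ih =
    trans (cong₂ ℤ._+_ rx≡u ih)
          (trans (step-u u (+ count u xs) (+ count v xs ℤ.* v))
                 (cong (λ m → m ℤ.* u ℤ.+ + count v xs ℤ.* v) (sym (pos-+ 1 (count u xs)))))
    where
    step-u : ∀ u m t → u ℤ.+ (m ℤ.* u ℤ.+ t) ≡ (+ 1 ℤ.+ m) ℤ.* u ℤ.+ t
    step-u = ℤ-Ring.solve-∀
  ... | no _     | yes rx≡v | ih =
    trans (cong₂ ℤ._+_ rx≡v ih)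
          (trans (step-v v (+ count u xs ℤ.* u) (+ count v xs))
                 (cong (λ m → + count u xs ℤ.* u ℤ.+ m ℤ.* v) (sym (pos-+ 1 (count v xs)))))
    where
    step-v : ∀ v s m → v ℤ.+ (s ℤ.+ m ℤ.* v) ≡ s ℤ.+ (+ 1 ℤ.+ m) ℤ.* v
    step-v = ℤ-Ring.solve-∀
  ... | no rx≢u  | no rx≢v  | _  with twoValued (here refl)
  ...   | inj₁ rx≡u = contradiction rx≡u rx≢u
  ...   | inj₂ rx≡v = contradiction rx≡v rx≢v

count-from-sum : ∀ {p c m k} .{{_ : NonZero p}} → m + k ≡ p →
                 + m ℤ.* (+ c ℤ.- + p) ℤ.+ + k ℤ.* + c ≡ + 0 → m ≡ c
count-from-sum {p} {c} {m} {k} m+k≡p eq = sym (*-cancelʳ-≡ c m p (ℤP.+-injective (ℤP.i-j≡0⇒i≡j _ _ (begin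
  + (c * p) ℤ.- + (m * p)                  ≡⟨ cong (λ n → + (c * n) ℤ.- + (m * p)) m+k≡p ⟨
  + (c * (m + k)) ℤ.- + (m * p)            ≡⟨ cong₂ ℤ._-_ (trans (pos-* c (m + k)) (cong (ℤ._*_ (+ c)) (pos-+ m k)))
                                                         (pos-* m p) ⟩
  + c ℤ.* (+ m ℤ.+ + k) ℤ.- + m ℤ.* + p    ≡⟨ regroup (+ m) (+ k) (+ c) (+ p) ⟩
  + m ℤ.* (+ c ℤ.- + p) ℤ.+ + k ℤ.* + c    ≡⟨ eq ⟩
  + 0                                      ∎))))
  where
  open ≡-Reasoning
  regroup : ∀ m k c p → c ℤ.* (m ℤ.+ k) ℤ.- m ℤ.* p ≡ m ℤ.* (c ℤ.- p) ℤ.+ k ℤ.* c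
  regroup = ℤ-Ring.solve-∀

difference-values : ∀ {p t c} → t + c ≡ p ⊎ t + c ≡ p + p → + p ℤ.- + t ≡ + c ℤ.- + p ⊎ + p ℤ.- + t ≡ + c
difference-values {p} {t} {c} (inj₁ t+c≡p) = inj₂ (begin
  + p ℤ.- + t            ≡⟨ cong (λ m → + m ℤ.- + t) t+c≡p ⟨
  + (t + c) ℤ.- + t      ≡⟨ cong (ℤ._- + t) (pos-+ t c) ⟩
  (+ t ℤ.+ + c) ℤ.- + t  ≡⟨ cancel (+ t) (+ c) ⟩
  + c                    ∎)
  where
  open ≡-Reasoning
  cancel : ∀ t c → (t ℤ.+ c) ℤ.- t ≡ c
  cancel = ℤ-Ring.solve-∀
difference-values {p} {t} {c} (inj₂ t+c≡2p) = inj₁ (begin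
  + p ℤ.- + t                                         ≡⟨ regroup (+ p) (+ t) (+ c) ⟩
  (+ c ℤ.- + p) ℤ.+ ((+ p ℤ.+ + p) ℤ.- (+ t ℤ.+ + c))  ≡⟨ cong (ℤ._+_ (+ c ℤ.- + p)) balance ⟩
  (+ c ℤ.- + p) ℤ.+ + 0                               ≡⟨ ℤP.+-identityʳ _ ⟩
  + c ℤ.- + p                                         ∎)
  where
  open ≡-Reasoning
  regroup : ∀ p t c → p ℤ.- t ≡ (c ℤ.- p) ℤ.+ ((p ℤ.+ p) ℤ.- (t ℤ.+ c))
  regroup = ℤ-Ring.solve-∀
  balance : (+ p ℤ.+ + p) ℤ.- (+ t ℤ.+ + c) ≡ + 0
  balance = ℤP.i≡j⇒i-j≡0 (trans (sym (pos-+ p p)) (trans (cong +_ (sym t+c≡2p)) (pos-+ t c)))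

-- The polynomial P of degree d modulo p = 2d + 1

module FixedPolynomial {d : ℕ} (p-prime : Prime (suc (d + d))) (a : Fin (suc d) → ℕ)
                       (sum-values : sum (map (evalPoly (suc (d + d)) a) (upTo (suc (d + d)))) ≡ suc (d + d)) where

  p : ℕ
  p = suc (d + d)

  V : ℕ → ℕ
  V = evalPoly p a

  c : ℕ
  c = a (fromℕ d)

  χ : ℕ → ℕ → ℤ
  χ γ x = legendre p (subMod p x γ)

  parabola : ℕ → ℕ → ℕ
  parabola γ y = (y * y + γ) % p

  parabolaSum : ℕ → ℕ
  parabolaSum γ = ∑ℕ[ y < p ] V (parabola γ y)

  N : ℕ → ℕ → ℕ
  N γ = fibreSize (parabola γ) p

  ΣV≡p : sumBelow p V ≡ p
  ΣV≡p = trans (sym (sum-map-upTo p V)) sum-values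

  ΣN≡p : ∀ γ → sumBelow p (N γ) ≡ p
  ΣN≡p γ = begin
    sumBelow p (N γ)         ≡⟨ sumBelow-cong p (λ x _ → *-identityˡ (N γ x)) ⟨
    ∑ℕ[ x < p ] (1 * N γ x)  ≡⟨ sumBelow-fibres p (parabola γ) (λ _ → 1) (λ y _ → m%n<n (y * y + γ) p) ⟨
    ∑ℕ[ y < p ] 1            ≡⟨ sumBelow-const p 1 ⟩
    p * 1                    ≡⟨ *-identityʳ p ⟩
    p                        ∎
    where open ≡-Reasoning

  parabolaSum≡ΣVN : ∀ γ → parabolaSum γ ≡ ∑ℕ[ x < p ] (V x * N γ x)
  parabolaSum≡ΣVN γ = sumBelow-fibres p (parabola γ) V (λ y _ → m%n<n (y * y + γ) p)

  N≡rootCount : ∀ {γ x} → γ < p → x < p → N γ x ≡ rootCount p (subMod p x γ)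
  N≡rootCount {γ} {x} γ<p x<p =
    sumBelow-cong p {λ y → δ (parabola γ y) x} {λ y → δ ((y * y) % p) (subMod p x γ)}
      (λ y _ → δ-cong (%-shift⁻ {s = y * y} (<⇒≤ γ<p)) (%-shift⁺ {s = y * y} (<⇒≤ γ<p) x<p))

  χ≡N-1 : ∀ {γ x} → γ < p → x < p → χ γ x ≡ + N γ x ℤ.- + 1
  χ≡N-1 {γ} {x} γ<p x<p =
    trans (legendre≡rootCount-1 {d} p-prime {subMod p x γ} (m%n<n (x + (p ∸ γ)) p))
          (cong (λ m → + m ℤ.- + 1) (sym (N≡rootCount γ<p x<p)))

  N≤2 : ∀ {γ x} → γ < p → x < p → N γ x ≤ 2
  N≤2 {γ} {x} γ<p x<p = ℤP.drop‿+≤+ (begin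
    + N γ x                    ≡⟨ add-sub (+ N γ x) ⟩
    (+ N γ x ℤ.- + 1) ℤ.+ + 1  ≡⟨ cong (ℤ._+ + 1) (χ≡N-1 γ<p x<p) ⟨
    χ γ x ℤ.+ + 1              ≤⟨ ℤP.+-monoˡ-≤ (+ 1) (legendre≤1 p (subMod p x γ)) ⟩
    + 2                        ∎)
    where
    open ℤP.≤-Reasoning
    add-sub : ∀ m → m ≡ (m ℤ.- + 1) ℤ.+ + 1
    add-sub = ℤ-Ring.solve-∀

  rγ≡p-parabolaSum : ∀ {γ} → γ < p → rγ p a γ ≡ + p ℤ.- + parabolaSum γ
  rγ≡p-parabolaSum {γ} γ<p = begin
    rγ p a γ
      ≡⟨ sumℤ-filter-split V (χ γ) (upTo p) ⟩
    sumℤ (map (λ x → (+ 1 ℤ.- + V x) ℤ.* χ γ x) (upTo p))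
      ≡⟨ cong sumℤ (map-cong-upTo p pointwise) ⟩
    sumℤ (map (λ x → + (N γ x + V x) ℤ.- + (V x * N γ x + 1)) (upTo p))
      ≡⟨ sumℤ-map-⊖ (λ x → N γ x + V x) (λ x → V x * N γ x + 1) (upTo p) ⟩
    + sum (map (λ x → N γ x + V x) (upTo p)) ℤ.- + sum (map (λ x → V x * N γ x + 1) (upTo p))
      ≡⟨ cong₂ (λ u v → + u ℤ.- + v) (trans (sum-map-upTo p (λ x → N γ x + V x)) ΣN+V)
                                     (trans (sum-map-upTo p (λ x → V x * N γ x + 1)) ΣVN+1) ⟩
    + (p + p) ℤ.- + (parabolaSum γ + p)
      ≡⟨ cong₂ ℤ._-_ (pos-+ p p) (pos-+ (parabolaSum γ) p) ⟩
    (+ p ℤ.+ + p) ℤ.- (+ parabolaSum γ ℤ.+ + p)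
      ≡⟨ cancel (+ p) (+ parabolaSum γ) ⟩
    + p ℤ.- + parabolaSum γ ∎
    where
    open ≡-Reasoning
    expand : ∀ v m → (+ 1 ℤ.- v) ℤ.* (m ℤ.- + 1) ≡ (m ℤ.+ v) ℤ.- (v ℤ.* m ℤ.+ + 1)
    expand = ℤ-Ring.solve-∀
    cancel : ∀ p t → (p ℤ.+ p) ℤ.- (t ℤ.+ p) ≡ p ℤ.- t
    cancel = ℤ-Ring.solve-∀
    pointwise : ∀ {x} → x < p → (+ 1 ℤ.- + V x) ℤ.* χ γ x ≡ + (N γ x + V x) ℤ.- + (V x * N γ x + 1)
    pointwise {x} x<p = begin
      (+ 1 ℤ.- + V x) ℤ.* χ γ x                            ≡⟨ cong (ℤ._*_ (+ 1 ℤ.- + V x)) (χ≡N-1 γ<p x<p) ⟩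
      (+ 1 ℤ.- + V x) ℤ.* (+ N γ x ℤ.- + 1)                ≡⟨ expand (+ V x) (+ N γ x) ⟩
      (+ N γ x ℤ.+ + V x) ℤ.- (+ V x ℤ.* + N γ x ℤ.+ + 1)  ≡⟨ cong₂ ℤ._-_ (pos-+ (N γ x) (V x)) pos-VN+1 ⟨
      + (N γ x + V x) ℤ.- + (V x * N γ x + 1)              ∎
      where
      pos-VN+1 : + (V x * N γ x + 1) ≡ + V x ℤ.* + N γ x ℤ.+ + 1
      pos-VN+1 = trans (pos-+ (V x * N γ x) 1) (cong (ℤ._+ + 1) (pos-* (V x) (N γ x)))
    ΣN+V : ∑ℕ[ x < p ] (N γ x + V x) ≡ p + p
    ΣN+V = trans (∑-distrib-+ {p} (N γ ∘ toℕ) (V ∘ toℕ)) (cong₂ _+_ (ΣN≡p γ) ΣV≡p)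
    ΣVN+1 : ∑ℕ[ x < p ] (V x * N γ x + 1) ≡ parabolaSum γ + p
    ΣVN+1 = trans (∑-distrib-+ {p} (λ x → V (toℕ x) * N γ (toℕ x)) (λ _ → 1))
                  (cong₂ _+_ (sym (parabolaSum≡ΣVN γ)) (trans (sumBelow-const p 1) (*-identityʳ p)))

  parabolaSum≤2p : ∀ {γ} → γ < p → parabolaSum γ ≤ p + p
  parabolaSum≤2p {γ} γ<p = begin
    parabolaSum γ              ≡⟨ parabolaSum≡ΣVN γ ⟩
    ∑ℕ[ x < p ] (V x * N γ x)  ≤⟨ sumBelow-mono-≤ p (λ x x<p → *-monoʳ-≤ (V x) (N≤2 γ<p x<p)) ⟩
    ∑ℕ[ x < p ] (V x * 2)      ≡⟨ sumBelow-cong p (λ x _ → *-comm (V x) 2) ⟩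
    ∑ℕ[ x < p ] (2 * V x)      ≡⟨ *-distribˡ-sumBelow p 2 V ⟨
    2 * sumBelow p V           ≡⟨ cong (2 *_) ΣV≡p ⟩
    2 * p                      ≡⟨ cong (_+_ p) (+-identityʳ p) ⟩
    p + p                      ∎
    where open ≤-Reasoning

  p∣parabolaSum+c : ∀ γ → p ∣ parabolaSum γ + c
  p∣parabolaSum+c γ = ≈0-mod⇒∣ (begin
    parabolaSum γ + c
      ≈⟨ +-cong-mod (sumBelow-cong-mod p (λ y _ → V≈evalℕ (y * y + γ))) mod-refl ⟩
    ∑ℕ[ y < p ] evalℕ a (y * y + γ) + c
      ≈⟨ sum-evalℕ-parabola p-prime a γ ⟩
    0 ∎)
    where
    open import Relation.Binary.Reasoning.Setoid (mod-setoid p)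
    V≈evalℕ : ∀ z → V (z % p) ≈ evalℕ a z mod p
    V≈evalℕ z = begin
      V (z % p)            ≡⟨ cong (_% p) (sum-map-tabulate (suc d) id (λ i → a i * (z % p) ^ toℕ i)) ⟩
      evalℕ a (z % p) % p  ≈⟨ %-≈-mod (evalℕ a (z % p)) ⟩
      evalℕ a (z % p)      ≈⟨ evalℕ-cong-mod a (%-≈-mod z) ⟩
      evalℕ a z            ∎

  rγ-values : ∀ {γ} → γ < p → 1 ≤ c → c < p → rγ p a γ ≡ + c ℤ.- + p ⊎ rγ p a γ ≡ + c
  rγ-values {γ} γ<p 1≤c c<p = Sum.map (trans (rγ≡p-parabolaSum γ<p)) (trans (rγ≡p-parabolaSum γ<p))
    (difference-values (∣∧<3*⇒≡⊎≡2* (p∣parabolaSum+c γ) (≤-trans 1≤c (m≤n+m c (parabolaSum γ)))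
                                      (+-mono-≤-< (parabolaSum≤2p γ<p) c<p)))

  ΣparabolaSum≡p*p : sumBelow p parabolaSum ≡ p * p
  ΣparabolaSum≡p*p = begin
    ∑ℕ[ γ < p ] ∑ℕ[ y < p ] V ((y * y + γ) % p)  ≡⟨ sumBelow-comm p p (λ γ y → V ((y * y + γ) % p)) ⟩
    ∑ℕ[ y < p ] ∑ℕ[ γ < p ] V ((y * y + γ) % p)
      ≡⟨ sumBelow-cong p (λ y _ → sumBelow-periodic p (y * y) (V ∘ (_% p)) period) ⟩
    ∑ℕ[ y < p ] ∑ℕ[ γ < p ] V (γ % p)
      ≡⟨ sumBelow-cong p (λ _ _ → sumBelow-cong p (λ γ γ<p → cong V (m<n⇒m%n≡m γ<p))) ⟩
    ∑ℕ[ y < p ] sumBelow p V                     ≡⟨ sumBelow-cong p (λ _ _ → ΣV≡p) ⟩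
    ∑ℕ[ y < p ] p                                ≡⟨ sumBelow-const p p ⟩
    p * p                                        ∎
    where
    open ≡-Reasoning
    period : ∀ i → V ((p + i) % p) ≡ V (i % p)
    period i = cong V (trans (cong (_% p) (+-comm p i)) ([m+n]%n≡m%n i p))

  Σrγ≡0 : sumℤ (map (rγ p a) (upTo p)) ≡ + 0
  Σrγ≡0 = begin
    sumℤ (map (rγ p a) (upTo p))                          ≡⟨ cong sumℤ (map-cong-upTo p rγ≡p-parabolaSum) ⟩
    sumℤ (map (λ γ → + p ℤ.- + parabolaSum γ) (upTo p))   ≡⟨ sumℤ-map-⊖ (λ _ → p) parabolaSum (upTo p) ⟩
    + sum (map (λ _ → p) (upTo p)) ℤ.- + sum (map parabolaSum (upTo p))
      ≡⟨ cong₂ (λ u v → + u ℤ.- + v) (trans (sum-map-upTo p (λ _ → p)) (sumBelow-const p p))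
                                     (trans (sum-map-upTo p parabolaSum) ΣparabolaSum≡p*p) ⟩
    + (p * p) ℤ.- + (p * p)                               ≡⟨ ℤP.+-inverseʳ (+ (p * p)) ⟩
    + 0                                                   ∎
    where open ≡-Reasoning

  counts : 1 ≤ c → c < p →
    (length (filter (λ γ → rγ p a γ ≟ℤ (+ c) ℤ.- (+ p)) (upTo p)) ≡ c)
    × (length (filter (λ γ → rγ p a γ ≟ℤ (+ c)) (upTo p)) ≡ p ∸ c)
  counts 1≤c c<p =
    count≡c , trans (sym (m+n∸m≡n (count (+ c ℤ.- + p) (upTo p)) _)) (cong₂ _∸_ total count≡c)
    where
    c-p≢c : + c ℤ.- + p ≢ + c
    c-p≢c eq = 1+n≢0 (ℤP.+-injective
      (trans (solve-p (+ c) (+ p)) (trans (cong (ℤ._-_ (+ c)) eq) (ℤP.+-inverseʳ (+ c)))))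
      where
      solve-p : ∀ c p → p ≡ c ℤ.- (c ℤ.- p)
      solve-p = ℤ-Ring.solve-∀
    open TwoValuedCount (rγ p a) c-p≢c
    twoValued : TwoValued (upTo p)
    twoValued γ∈ = rγ-values (∈-upTo⁻ γ∈) 1≤c c<p
    total : count (+ c ℤ.- + p) (upTo p) + count (+ c) (upTo p) ≡ p
    total = trans (count-two-valued (upTo p) twoValued) (length-upTo p)
    count≡c : count (+ c ℤ.- + p) (upTo p) ≡ c
    count≡c = count-from-sum total (trans (sym (sumℤ-two-valued (upTo p) twoValued)) Σrγ≡0)

odd⇒≡half+half : ∀ n → suc n % 2 ≡ 1 → n ≡ half (suc n) + half (suc n)
odd⇒≡half+half n odd = begin
  n                          ≡⟨ m≡m%n+[m/n]*n n 2 ⟩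
  n % 2 + n / 2 * 2          ≡⟨ cong (_+ n / 2 * 2) (even n odd) ⟩
  n / 2 * 2                  ≡⟨ *-comm (n / 2) 2 ⟩
  n / 2 + (n / 2 + 0)        ≡⟨ cong (_+_ (n / 2)) (+-identityʳ (n / 2)) ⟩
  n / 2 + n / 2              ∎
  where
  open ≡-Reasoning
  even : ∀ n → suc n % 2 ≡ 1 → n % 2 ≡ 0
  even n odd with n % 2 | m%n<n n 2 | %-distribˡ-+ 1 n 2
  ... | 0 | _ | _ = refl
  ... | 1 | _ | eq = contradiction (trans (sym odd) eq) λ ()
  ... | suc (suc _) | s≤s (s≤s ()) | _

corollary-for-2d+1 : ∀ n d → n ≡ d + d → Prime (suc n) →
    (a : Fin (suc d) → ℕ) → (∀ i → a i < suc n) → 1 ≤ a (fromℕ d) →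
    sum (map (evalPoly (suc n) a) (upTo (suc n))) ≡ suc n →
    (length (filter (λ γ → rγ (suc n) a γ ≟ℤ (+ a (fromℕ d)) ℤ.- (+ suc n)) (upTo (suc n))) ≡ a (fromℕ d))
    × (length (filter (λ γ → rγ (suc n) a γ ≟ℤ (+ a (fromℕ d))) (upTo (suc n))) ≡ suc n ∸ a (fromℕ d))
corollary-for-2d+1 .(d + d) d refl p-prime a a<p 1≤c sum-values =
  FixedPolynomial.counts p-prime a sum-values 1≤c (a<p (fromℕ d))

corollary3p4 : (p : ℕ) .{{_ : NonZero p}} → Prime p → p % 2 ≡ 1 →
    (a : Fin (suc (half p)) → ℕ) → (∀ i → a i < p) → 1 ≤ a (fromℕ (half p)) →
    sum (map (evalPoly p a) (upTo p)) ≡ p →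
    (length (filter (λ γ → rγ p a γ ≟ℤ (+ a (fromℕ (half p))) ℤ.- (+ p)) (upTo p))
       ≡ a (fromℕ (half p)))
    × (length (filter (λ γ → rγ p a γ ≟ℤ (+ a (fromℕ (half p)))) (upTo p))
       ≡ p ∸ a (fromℕ (half p)))
corollary3p4 (suc n) p-prime odd = corollary-for-2d+1 n (half (suc n)) (odd⇒≡half+half n odd) p-prime
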